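{- Let $k$ be a field, $V=k^2$, and take $v_1=\begin{pmatrix}1\\0\end{pmatrix}$, $\lambda_1=\begin{pmatrix}0&1\end{pmatrix}$, $v_2=\begin{pmatrix}0\\1\end{pmatrix}$, $\lambda_2=\begin{pmatrix}1&0\end{pmatrix}$, $v_3=\begin{pmatrix}1\\1\end{pmatrix}$, $\lambda_3=\begin{pmatrix}1&-1\end{pmatrix}$, and $c_{i,j}=v_i\lambda_j$ (a $2\times2$ matrix). Then $\lambda_1(v_2)\lambda_2(v_3)\lambda_3(v_1)=1$, and the identity $$ab=\mathrm{tr}(a)\mathrm{tr}(b)I+\sum_{\sigma\in S_3}\varepsilon(\sigma)\,\mathrm{tr}(ac_{\sigma(1),\sigma(2)})\,\mathrm{tr}(bc_{\sigma(2),\sigma(3)})\,c_{\sigma(3),\sigma(1)}$$ (valid for all $2\times2$ matrices $a,b$ over $k$) is exactly Strassen's original algorithm: writing $a=(a^{i,j})$, $b=(b^{i,j})$, $e_{i,j}$ for the elementary matrices, and $\mathrm{I}=(a^{1,1}+a^{2,2})(b^{1,1}+b^{2,2})$, $\mathrm{II}=(a^{2,1}+a^{2,2})b^{1,1}$, $\mathrm{III}=a^{1,1}(b^{1,2}-b^{2,2})$, $\mathrm{IV}=a^{2,2}(b^{2,1}-b^{1,1})$, $\mathrm{V}=(a^{1,1}+a^{1,2})b^{2,2}$, $\mathrm{VI}=(a^{2,1}-a^{1,1})(b^{1,1}+b^{1,2})$, $\mathrm{VII}=(a^{1,2}-a^{2,2})(b^{2,1}+b^{2,2})$, the seven terms of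 the identity are respectively $\mathrm{I}(e_{1,1}+e_{2,2})$, $\mathrm{III}(e_{1,2}+e_{2,2})$, $\mathrm{VII}\,e_{1,1}$, $\mathrm{II}(e_{2,1}-e_{2,2})$, $\mathrm{IV}(e_{1,1}+e_{2,1})$, $\mathrm{VI}\,e_{2,2}$, $\mathrm{V}(e_{1,2}-e_{1,1})$, so that $(ab)^{1,1}=\mathrm{I}+\mathrm{IV}-\mathrm{V}+\mathrm{VII}$, $(ab)^{1,2}=\mathrm{III}+\mathrm{V}$, $(ab)^{2,1}=\mathrm{II}+\mathrm{IV}$, $(ab)^{2,2}=\mathrm{I}-\mathrm{II}+\mathrm{III}+\mathrm{VI}$.
   Context: Column vectors represent elements of $k^2$ and row vectors linear forms on $k^2$; $v_i\lambda_j$ is the column-times-row matrix product, i.e. the linear map $u\mapsto\lambda_j(u)v_i$. $I$ is the $2\times2$ identity matrix and $\varepsilon(\sigma)$ is the signature of $\sigma\in S_3$. -}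

module Defs where

open import Level using (Level; _⊔_) renaming (suc to lsuc)
open import Algebra.Bundles using (CommutativeRing)
open import Data.Fin using (Fin; zero; suc; _<?_)
open import Data.Fin.Properties using (_≟_)
open import Data.Product using (∃; _×_)
open import Relation.Nullary using (¬_; yes; no)

record Field (c ℓ : Level) : Set (lsuc (c ⊔ ℓ)) where
  field
    commutativeRing : CommutativeRing c ℓ
  open CommutativeRing commutativeRing
  field
    1≉0 : ¬ (1# ≈ 0#)
    inverse : ∀ x → ¬ (x ≈ 0#) → ∃ λ y → x * y ≈ 1#

-- index names (1-based names, 0-based Fin values)
i₁ i₂ i₃ : Fin 3
i₁ = zero
i₂ = suc zero
i₃ = suc (suc zero)

r₁ r₂ : Fin 2
r₁ = zero
r₂ = suc zero

perm : Fin 3 → Fin 3 → Fin 3 → (Fin 3 → Fin 3)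
perm x y z zero = x
perm x y z (suc zero) = y
perm x y z (suc (suc zero)) = z

module Matrices {c ℓ : Level} (R : CommutativeRing c ℓ) where
  open CommutativeRing R

  infixl 6 _+M_ _-M_
  infixl 7 _·M_ _⋆_
  infix 4 _≈M_

  Col : Set c
  Col = Fin 2 → Carrier

  Row : Set c
  Row = Fin 2 → Carrier

  Mat : Set c
  Mat = Fin 2 → Fin 2 → Carrier

  col : Carrier → Carrier → Col
  col x y zero = x
  col x y (suc zero) = y

  row : Carrier → Carrier → Row
  row x y zero = x
  row x y (suc zero) = y

  ⟪_⟫ : Row → Col → Carrier
  ⟪ μ ⟫ u = μ r₁ * u r₁ + μ r₂ * u r₂

  -- column-times-row product  v μ  (the map u ↦ μ(u) v)
  outer : Col → Row → Mat
  outer v μ i j = v i * μ j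

  _≈M_ : Mat → Mat → Set ℓ
  a ≈M b = ∀ i j → a i j ≈ b i j

  _+M_ : Mat → Mat → Mat
  (a +M b) i j = a i j + b i j

  _-M_ : Mat → Mat → Mat
  (a -M b) i j = a i j - b i j

  _⋆_ : Carrier → Mat → Mat
  (x ⋆ a) i j = x * a i j

  _·M_ : Mat → Mat → Mat
  (a ·M b) i j = a i r₁ * b r₁ j + a i r₂ * b r₂ j

  0M : Mat
  0M i j = 0#

  tr : Mat → Carrier
  tr a = a r₁ r₁ + a r₂ r₂

  Id : Mat
  Id zero zero = 1#
  Id zero (suc zero) = 0#
  Id (suc zero) zero = 0#
  Id (suc zero) (suc zero) = 1#

  e : Fin 2 → Fin 2 → Mat
  e i j p q with i ≟ p | j ≟ q
  ... | yes _ | yes _ = 1#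
  ... | _ | _ = 0#

  v : Fin 3 → Col
  v zero = col 1# 0#
  v (suc zero) = col 0# 1#
  v (suc (suc zero)) = col 1# 1#

  λ′ : Fin 3 → Row
  λ′ zero = row 0# 1#
  λ′ (suc zero) = row 1# 0#
  λ′ (suc (suc zero)) = row 1# (- 1#)

  cm : Fin 3 → Fin 3 → Mat
  cm i j = outer (v i) (λ′ j)

  -- signature of a map σ : {1,2,3} → {1,2,3} via inversions:
  -- product over pairs i < j of (+1 if σ(i) < σ(j), −1 otherwise)
  inv-sign : Fin 3 → Fin 3 → Carrier
  inv-sign x y with x <? y
  ... | yes _ = 1#
  ... | no _ = - 1#

  ε : (Fin 3 → Fin 3) → Carrier
  ε σ = inv-sign (σ i₁) (σ i₂) * inv-sign (σ i₁) (σ i₃) * inv-sign (σ i₂) (σ i₃)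

  -- sum over S₃: over all triples (σ(1),σ(2),σ(3)) of pairwise distinct elements
  sumS₃ : ((Fin 3 → Fin 3) → Mat) → Mat
  sumS₃ F = Σ3 λ x → Σ3 λ y → Σ3 λ z → pick x y z
    where
    Σ3 : (Fin 3 → Mat) → Mat
    Σ3 f = f i₁ +M f i₂ +M f i₃
    pick : Fin 3 → Fin 3 → Fin 3 → Mat
    pick x y z with x ≟ y | x ≟ z | y ≟ z
    ... | no _ | no _ | no _ = F (perm x y z)
    ... | _ | _ | _ = 0M

  term : Mat → Mat → (Fin 3 → Fin 3) → Mat
  term a b σ = (ε σ * tr (a ·M cm (σ i₁) (σ i₂)) * tr (b ·M cm (σ i₂) (σ i₃))) ⋆ cm (σ i₃) (σ i₁)

  sI sII sIII sIV sV sVI sVII : Mat → Mat → Carrier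
  sI a b = (a r₁ r₁ + a r₂ r₂) * (b r₁ r₁ + b r₂ r₂)
  sII a b = (a r₂ r₁ + a r₂ r₂) * b r₁ r₁
  sIII a b = a r₁ r₁ * (b r₁ r₂ - b r₂ r₂)
  sIV a b = a r₂ r₂ * (b r₂ r₁ - b r₁ r₁)
  sV a b = (a r₁ r₁ + a r₁ r₂) * b r₂ r₂
  sVI a b = (a r₂ r₁ - a r₁ r₁) * (b r₁ r₁ + b r₁ r₂)
  sVII a b = (a r₁ r₂ - a r₂ r₂) * (b r₂ r₁ + b r₂ r₂)

-- Every claim is a polynomial identity with integer coefficients in the eight entries of a
-- and b, so it suffices to prove it for generic matrices A, B whose entries are eight
-- variables, in the ring of integer expressions in these variables (identified when they take
-- equal values on R⁸). There an identity holds as soon as both sides have the same normal form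
-- under the standard library's ring normaliser, which is checked by computation; evaluating
-- the variables at the entries of a and b then gives the claim for a and b. The trace formula
-- is assembled as in the paper: tr(a) tr(b) I and the six summands over S₃ are Strassen's
-- seven products times fixed matrices, which add up to Strassen's expression for a b.
module Submission where

open import Defs
open import Level using (Level; 0ℓ; _⊔_)
open import Algebra.Bundles using (Ring; CommutativeRing; RawRing)
import Algebra.Construct.Pointwise as Pointwise
open import Algebra.Morphism.Structures using (IsRingMonomorphism)
import Algebra.Morphism.RingMonomorphism as RingMonomorphism
open import Data.Bool.Base using (Bool; true; false; T)
open import Data.Fin.Base using (Fin; zero; suc; combine; _↑ˡ_; _↑ʳ_)
open import Data.Integer.Base as ℤ using (ℤ; +_; -[1+_]; _⊖_)
import Data.Integer.Properties as ℤ
open import Data.Maybe.Base using (nothing)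
open import Data.Nat.Base as ℕ using (ℕ)
import Data.Nat.Properties as ℕ
open import Data.Product.Base using (_×_; _,_)
open import Data.Vec.Base using (Vec; []; _∷_; replicate)
open import Data.Vec.Functional.Relation.Binary.Equality.Setoid using (≋-setoid)
open import Relation.Binary.Bundles using (Setoid)
open import Relation.Binary.PropositionalEquality as ≡ using (_≡_)
open import Tactic.RingSolver.Core.AlmostCommutativeRing using (fromCommutativeRing)
open import Tactic.RingSolver.Core.Expression using (Expr; Κ; Ι; _⊕_; _⊗_; _⊛_; ⊝_; module Eval)
open import Tactic.RingSolver.Core.Polynomial.Parameters using (Homomorphism)

module FromInteger {c ℓ : Level} (R : Ring c ℓ) where
  open Ring R
  open import Algebra.Properties.Semiring.Mult.TCOptimised semiring
    using (1+×; ×-homo-+; ×1-homo-*) renaming (_×_ to _×′_)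
  open import Algebra.Properties.Ring R
    using (-‿involutive; -0#≈0#; -‿distribˡ-*; -‿distribʳ-*; -‿+-comm; xyx⁻¹≈y)
  open import Relation.Binary.Reasoning.Setoid setoid

  fromℤ : ℤ → Carrier
  fromℤ (+ n)    = n ×′ 1#
  fromℤ -[1+ n ] = - (ℕ.suc n ×′ 1#)

  -‿homo : ∀ i → fromℤ (ℤ.- i) ≈ - fromℤ i
  -‿homo (+ ℕ.zero) = sym -0#≈0#
  -‿homo ℤ.+[1+ n ] = refl
  -‿homo -[1+ n ]   = sym (-‿involutive _)

  +-cancelˡ-− : ∀ a x y → (a + x) - (a + y) ≈ x - y
  +-cancelˡ-− a x y = begin
    (a + x) - (a + y)      ≈⟨ +-congˡ (-‿+-comm a y) ⟨
    (a + x) + (- a + - y)  ≈⟨ +-assoc _ _ _ ⟨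
    (a + x - a) - y        ≈⟨ +-congʳ (xyx⁻¹≈y a x) ⟩
    x - y                  ∎

  ⊖-homo : ∀ m n → fromℤ (m ⊖ n) ≈ m ×′ 1# - n ×′ 1#
  ⊖-homo m ℕ.zero = begin
    m ×′ 1#        ≈⟨ +-identityʳ _ ⟨
    m ×′ 1# + 0#   ≈⟨ +-congˡ -0#≈0# ⟨
    m ×′ 1# - 0#   ∎
  ⊖-homo ℕ.zero (ℕ.suc n) = sym (+-identityˡ _)
  ⊖-homo (ℕ.suc m) (ℕ.suc n) = begin
    fromℤ (ℕ.suc m ⊖ ℕ.suc n)        ≡⟨ ≡.cong fromℤ (ℤ.[1+m]⊖[1+n]≡m⊖n m n) ⟩
    fromℤ (m ⊖ n)                    ≈⟨ ⊖-homo m n ⟩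
    m ×′ 1# - n ×′ 1#                ≈⟨ +-cancelˡ-− 1# _ _ ⟨
    (1# + m ×′ 1#) - (1# + n ×′ 1#)  ≈⟨ +-cong (1+× m 1#) (-‿cong (1+× n 1#)) ⟨
    ℕ.suc m ×′ 1# - ℕ.suc n ×′ 1#    ∎

  +-homo : ∀ i j → fromℤ (i ℤ.+ j) ≈ fromℤ i + fromℤ j
  +-homo (+ m)    (+ n)    = ×-homo-+ 1# m n
  +-homo (+ m)    -[1+ n ] = ⊖-homo m (ℕ.suc n)
  +-homo -[1+ m ] (+ n)    = trans (⊖-homo n (ℕ.suc m)) (+-comm _ _)
  +-homo -[1+ m ] -[1+ n ] = begin
    - (ℕ.suc (ℕ.suc (m ℕ.+ n)) ×′ 1#)      ≡⟨ ≡.cong (λ k → - (ℕ.suc k ×′ 1#)) (ℕ.+-suc m n) ⟨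
    - ((ℕ.suc m ℕ.+ ℕ.suc n) ×′ 1#)        ≈⟨ -‿cong (×-homo-+ 1# (ℕ.suc m) (ℕ.suc n)) ⟩
    - (ℕ.suc m ×′ 1# + ℕ.suc n ×′ 1#)      ≈⟨ -‿+-comm _ _ ⟨
    - (ℕ.suc m ×′ 1#) + - (ℕ.suc n ×′ 1#)  ∎

  +-*-homo : ∀ m j → fromℤ (+ m ℤ.* j) ≈ fromℤ (+ m) * fromℤ j
  +-*-homo m (+ n) = begin
    fromℤ (+ m ℤ.* + n)  ≡⟨ ≡.cong fromℤ (ℤ.pos-* m n) ⟨
    (m ℕ.* n) ×′ 1#      ≈⟨ ×1-homo-* m n ⟩
    m ×′ 1# * (n ×′ 1#)  ∎
  +-*-homo m -[1+ n ] = begin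
    fromℤ (+ m ℤ.* ℤ.- (+ ℕ.suc n))  ≡⟨ ≡.cong fromℤ (ℤ.neg-distribʳ-* (+ m) (+ ℕ.suc n)) ⟨
    fromℤ (ℤ.- (+ m ℤ.* + ℕ.suc n))  ≈⟨ -‿homo (+ m ℤ.* + ℕ.suc n) ⟩
    - fromℤ (+ m ℤ.* + ℕ.suc n)      ≈⟨ -‿cong (+-*-homo m (+ ℕ.suc n)) ⟩
    - (m ×′ 1# * (ℕ.suc n ×′ 1#))    ≈⟨ -‿distribʳ-* _ _ ⟩
    m ×′ 1# * - (ℕ.suc n ×′ 1#)      ∎

  *-homo : ∀ i j → fromℤ (i ℤ.* j) ≈ fromℤ i * fromℤ j
  *-homo (+ m)    j = +-*-homo m j
  *-homo -[1+ m ] j = begin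
    fromℤ (ℤ.- (+ ℕ.suc m) ℤ.* j)  ≡⟨ ≡.cong fromℤ (ℤ.neg-distribˡ-* (+ ℕ.suc m) j) ⟨
    fromℤ (ℤ.- (+ ℕ.suc m ℤ.* j))  ≈⟨ -‿homo (+ ℕ.suc m ℤ.* j) ⟩
    - fromℤ (+ ℕ.suc m ℤ.* j)      ≈⟨ -‿cong (+-*-homo (ℕ.suc m) j) ⟩
    - (ℕ.suc m ×′ 1# * fromℤ j)    ≈⟨ -‿distribˡ-* _ _ ⟩
    - (ℕ.suc m ×′ 1#) * fromℤ j    ∎

-- Tactic.RingSolver takes its coefficients from the ring itself and, for an abstract ring,
-- cannot decide when they vanish; so its normaliser is instantiated here with integer
-- coefficients, interpreted in R by fromℤ.
module IntegerPolynomials {c ℓ : Level} (R : CommutativeRing c ℓ) where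
  open CommutativeRing R
  open FromInteger ring

  isZero : ℤ → Bool
  isZero (+ ℕ.zero) = true
  isZero _          = false

  zero-homo : ∀ i → T (isZero i) → 0# ≈ fromℤ i
  zero-homo (+ ℕ.zero) _ = refl

  homomorphism : Homomorphism 0ℓ 0ℓ c ℓ
  homomorphism = record
    { from          = record { rawRing = ℤ.+-*-rawRing ; isZero = isZero }
    ; to            = fromCommutativeRing R (λ _ → nothing)
    ; morphism      = record
      { ⟦_⟧ = fromℤ ; +-homo = +-homo ; *-homo = *-homo ; -‿homo = -‿homo
      ; 0-homo = refl ; 1-homo = refl }
    ; Zero-C⟶Zero-R = zero-homo
    }

  open Eval rawRing fromℤ public using (⟦_⟧)
  open import Tactic.RingSolver.Core.Polynomial.Base (Homomorphism.from homomorphism)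
  open import Tactic.RingSolver.Core.Polynomial.Semantics homomorphism renaming (⟦_⟧ to ⟦_⟧ₚ)
  open import Tactic.RingSolver.Core.Polynomial.Homomorphism homomorphism
  open import Algebra.Properties.Semiring.Exp.TCOptimised semiring using (^-congˡ)
  open import Relation.Binary.Reasoning.Setoid setoid

  norm : ∀ {n} → Expr ℤ n → Poly n
  norm (Κ x)   = κ x
  norm (Ι x)   = ι x
  norm (x ⊕ y) = norm x ⊞ norm y
  norm (x ⊗ y) = norm x ⊠ norm y
  norm (⊝ x)   = ⊟ norm x
  norm (x ⊛ i) = norm x ⊡ i

  norm-correct : ∀ {n} (e : Expr ℤ n) ρ → ⟦ norm e ⟧ₚ ρ ≈ ⟦ e ⟧ ρ
  norm-correct (Κ x)   ρ = κ-hom x ρ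
  norm-correct (Ι x)   ρ = ι-hom x ρ
  norm-correct (x ⊕ y) ρ =
    trans (⊞-hom (norm x) (norm y) ρ) (+-cong (norm-correct x ρ) (norm-correct y ρ))
  norm-correct (x ⊗ y) ρ =
    trans (⊠-hom (norm x) (norm y) ρ) (*-cong (norm-correct x ρ) (norm-correct y ρ))
  norm-correct (⊝ x)   ρ = trans (⊟-hom (norm x) ρ) (-‿cong (norm-correct x ρ))
  norm-correct (x ⊛ i) ρ = trans (⊡-hom (norm x) i ρ) (^-congˡ i (norm-correct x ρ))

  -- A record rather than the Π-type itself, so that unification recovers the two expressions.
  infix 4 _≈ₑ_
  record _≈ₑ_ {n} (x y : Expr ℤ n) : Set (c ⊔ ℓ) where
    constructor values-agree
    field at : ∀ ρ → ⟦ x ⟧ ρ ≈ ⟦ y ⟧ ρ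

  open _≈ₑ_ public

  module _ (n : ℕ) where
    functionRing : CommutativeRing c (c ⊔ ℓ)
    functionRing = Pointwise.commutativeRing (Vec Carrier n) R

    expressionRawRing : RawRing 0ℓ (c ⊔ ℓ)
    expressionRawRing = record
      { Carrier = Expr ℤ n
      ; _≈_     = _≈ₑ_
      ; _+_     = _⊕_
      ; _*_     = _⊗_
      ; -_      = ⊝_
      ; 0#      = Κ (+ 0)
      ; 1#      = Κ (+ 1)
      }

    ⟦⟧-isRingMonomorphism :
      IsRingMonomorphism expressionRawRing (CommutativeRing.rawRing functionRing) ⟦_⟧
    ⟦⟧-isRingMonomorphism = record
      { isRingHomomorphism = record
        { isSemiringHomomorphism = record
          { isNearSemiringHomomorphism = record
            { +-isMonoidHomomorphism = record
              { isMagmaHomomorphism = record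
                { isRelHomomorphism = record { cong = at }
                ; homo = λ _ _ _ → refl }
              ; ε-homo = λ _ → refl }
            ; *-homo = λ _ _ _ → refl }
          ; 1#-homo = λ _ → refl }
        ; -‿homo = λ _ _ → refl }
      ; injective = values-agree
      }

    polynomialRing : CommutativeRing 0ℓ (c ⊔ ℓ)
    polynomialRing = record
      { isCommutativeRing = RingMonomorphism.isCommutativeRing ⟦⟧-isRingMonomorphism
          (CommutativeRing.isCommutativeRing functionRing)
      }

  ≈-by-norm : ∀ {n} {x y : Expr ℤ n} → norm x ≡ norm y → x ≈ₑ y
  ≈-by-norm {x = x} {y} eq = values-agree λ ρ → begin
    ⟦ x ⟧ ρ          ≈⟨ norm-correct x ρ ⟨
    ⟦ norm x ⟧ₚ ρ    ≡⟨ ≡.cong (λ p → ⟦ p ⟧ₚ ρ) eq ⟩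
    ⟦ norm y ⟧ₚ ρ    ≈⟨ norm-correct y ρ ⟩
    ⟦ y ⟧ ρ          ∎

Entries : ∀ {p} → (Fin 2 → Fin 2 → Set p) → Set p
Entries P = P r₁ r₁ × P r₁ r₂ × P r₂ r₁ × P r₂ r₂

from-entries : ∀ {p} {P : Fin 2 → Fin 2 → Set p} → Entries P → ∀ i j → P i j
from-entries (p₁₁ , p₁₂ , p₂₁ , p₂₂) zero       zero       = p₁₁
from-entries (p₁₁ , p₁₂ , p₂₁ , p₂₂) zero       (suc zero) = p₁₂
from-entries (p₁₁ , p₁₂ , p₂₁ , p₂₂) (suc zero) zero       = p₂₁
from-entries (p₁₁ , p₁₂ , p₂₁ , p₂₂) (suc zero) (suc zero) = p₂₂

to-entries : ∀ {p} {P : Fin 2 → Fin 2 → Set p} → (∀ i j → P i j) → Entries P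
to-entries f = f r₁ r₁ , f r₁ r₂ , f r₂ r₁ , f r₂ r₂

module MatrixEquality {c ℓ : Level} (R : CommutativeRing c ℓ) where
  open CommutativeRing R
  open Matrices R

  ≈M-setoid : Setoid c ℓ
  ≈M-setoid = ≋-setoid (≋-setoid setoid 2) 2

  infixl 6 _⟨+M⟩_
  _⟨+M⟩_ : ∀ {a b a′ b′} → a ≈M a′ → b ≈M b′ → a +M b ≈M a′ +M b′
  (p ⟨+M⟩ q) i j = +-cong (p i j) (q i j)

module GenericMatrices {c ℓ : Level} (R : CommutativeRing c ℓ) where
  open IntegerPolynomials R using (homomorphism; norm; ≈-by-norm; polynomialRing)
  open import Tactic.RingSolver.Core.Polynomial.Base (Homomorphism.from homomorphism) using (Poly)
  open CommutativeRing (polynomialRing 8)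
  open Matrices (polynomialRing 8)
  open MatrixEquality (polynomialRing 8)
  open Setoid ≈M-setoid using () renaming (refl to ≈M-refl)
  open import Relation.Binary.Reasoning.Setoid ≈M-setoid

  A B : Mat
  A i j = Ι (combine i j ↑ˡ 4)
  B i j = Ι (4 ↑ʳ combine i j)

  normᴹ : Mat → Entries (λ _ _ → Poly 8)
  normᴹ L = to-entries {P = λ _ _ → Poly 8} (λ i j → norm (L i j))

  ≈M-by-norm : ∀ {L M : Mat} → normᴹ L ≡ normᴹ M → L ≈M M
  ≈M-by-norm {L} {M} eq = from-entries
    (≈-by-norm (entry r₁ r₁) , ≈-by-norm (entry r₁ r₂) ,
     ≈-by-norm (entry r₂ r₁) , ≈-by-norm (entry r₂ r₂))
    where
    entry : ∀ i j → from-entries (normᴹ L) i j ≡ from-entries (normᴹ M) i j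
    entry i j = ≡.cong (λ t → from-entries {P = λ _ _ → Poly 8} t i j) eq

  λ₁v₂·λ₂v₃·λ₃v₁≈1 : ⟪ λ′ i₁ ⟫ (v i₂) * ⟪ λ′ i₂ ⟫ (v i₃) * ⟪ λ′ i₃ ⟫ (v i₁) ≈ 1#
  λ₁v₂·λ₂v₃·λ₃v₁≈1 = ≈-by-norm ≡.refl

  strassen₁₁ : (A ·M B) r₁ r₁ ≈ sI A B + sIV A B - sV A B + sVII A B
  strassen₁₁ = ≈-by-norm ≡.refl

  strassen₁₂ : (A ·M B) r₁ r₂ ≈ sIII A B + sV A B
  strassen₁₂ = ≈-by-norm ≡.refl

  strassen₂₁ : (A ·M B) r₂ r₁ ≈ sII A B + sIV A B
  strassen₂₁ = ≈-by-norm ≡.refl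

  strassen₂₂ : (A ·M B) r₂ r₂ ≈ sI A B - sII A B + sIII A B + sVI A B
  strassen₂₂ = ≈-by-norm ≡.refl

  trace-term≈I : (tr A * tr B) ⋆ Id ≈M sI A B ⋆ (e r₁ r₁ +M e r₂ r₂)
  trace-term≈I = ≈M-by-norm ≡.refl

  term₁₂₃≈III : term A B (perm i₁ i₂ i₃) ≈M sIII A B ⋆ (e r₁ r₂ +M e r₂ r₂)
  term₁₂₃≈III = ≈M-by-norm ≡.refl

  term₂₃₁≈VII : term A B (perm i₂ i₃ i₁) ≈M sVII A B ⋆ e r₁ r₁
  term₂₃₁≈VII = ≈M-by-norm ≡.refl

  term₃₁₂≈II : term A B (perm i₃ i₁ i₂) ≈M sII A B ⋆ (e r₂ r₁ -M e r₂ r₂)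
  term₃₁₂≈II = ≈M-by-norm ≡.refl

  term₂₁₃≈IV : term A B (perm i₂ i₁ i₃) ≈M sIV A B ⋆ (e r₁ r₁ +M e r₂ r₁)
  term₂₁₃≈IV = ≈M-by-norm ≡.refl

  term₁₃₂≈VI : term A B (perm i₁ i₃ i₂) ≈M sVI A B ⋆ e r₂ r₂
  term₁₃₂≈VI = ≈M-by-norm ≡.refl

  term₃₂₁≈V : term A B (perm i₃ i₂ i₁) ≈M sV A B ⋆ (e r₁ r₂ -M e r₁ r₁)
  term₃₂₁≈V = ≈M-by-norm ≡.refl

  sumPermutations : ((Fin 3 → Fin 3) → Mat) → Mat
  sumPermutations F =
    F (perm i₁ i₂ i₃) +M F (perm i₂ i₃ i₁) +M F (perm i₃ i₁ i₂) +M
    F (perm i₂ i₁ i₃) +M F (perm i₁ i₃ i₂) +M F (perm i₃ i₂ i₁)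

  sumS₃-expand : sumS₃ (term A B) ≈M sumPermutations (term A B)
  sumS₃-expand = ≈M-by-norm ≡.refl

  strassenSum : Mat
  strassenSum =
    sIII A B ⋆ (e r₁ r₂ +M e r₂ r₂) +M sVII A B ⋆ e r₁ r₁ +M sII A B ⋆ (e r₂ r₁ -M e r₂ r₂) +M
    sIV A B ⋆ (e r₁ r₁ +M e r₂ r₁) +M sVI A B ⋆ e r₂ r₂ +M sV A B ⋆ (e r₁ r₂ -M e r₁ r₁)

  strassen-algorithm : A ·M B ≈M sI A B ⋆ (e r₁ r₁ +M e r₂ r₂) +M strassenSum
  strassen-algorithm = ≈M-by-norm ≡.refl

  trace-formula : A ·M B ≈M (tr A * tr B) ⋆ Id +M sumS₃ (term A B)
  trace-formula = begin
    A ·M B                                            ≈⟨ strassen-algorithm ⟩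
    sI A B ⋆ (e r₁ r₁ +M e r₂ r₂) +M strassenSum      ≈⟨ trace-term≈I ⟨+M⟩ summands ⟨
    (tr A * tr B) ⋆ Id +M sumPermutations (term A B)  ≈⟨ ≈M-refl ⟨+M⟩ sumS₃-expand ⟨
    (tr A * tr B) ⋆ Id +M sumS₃ (term A B)            ∎
    where
    summands : sumPermutations (term A B) ≈M strassenSum
    summands = term₁₂₃≈III ⟨+M⟩ term₂₃₁≈VII ⟨+M⟩ term₃₁₂≈II ⟨+M⟩
               term₂₁₃≈IV ⟨+M⟩ term₁₃₂≈VI ⟨+M⟩ term₃₂₁≈V

module Specialisation {c ℓ : Level} (R : CommutativeRing c ℓ) where
  open CommutativeRing R
  open Matrices R
  open IntegerPolynomials R using (⟦_⟧; at)
  module G = Matrices (IntegerPolynomials.polynomialRing R 8)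

  point : Mat → Mat → Vec Carrier 8
  point a b = a r₁ r₁ ∷ a r₁ r₂ ∷ a r₂ r₁ ∷ a r₂ r₂ ∷ b r₁ r₁ ∷ b r₁ r₂ ∷ b r₂ r₁ ∷ b r₂ r₂ ∷ []

  -- ⟦ X A B ⟧ (point a b) reduces to X a b for the matrix expressions X of Defs, but only
  -- entry by entry at concrete indices; hence the result is given as Entries.
  specialise : ∀ {L M : G.Mat} → L G.≈M M → ∀ a b →
             Entries (λ i j → ⟦ L i j ⟧ (point a b) ≈ ⟦ M i j ⟧ (point a b))
  specialise L≈M a b = to-entries (λ i j → at (L≈M i j) (point a b))

corollary5p3 : {c ℓ : Level} (F : Field c ℓ) →
    let open Field F using (commutativeRing)
        open CommutativeRing commutativeRing
        open Matrices commutativeRing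
    in (⟪ λ′ i₁ ⟫ (v i₂) * ⟪ λ′ i₂ ⟫ (v i₃) * ⟪ λ′ i₃ ⟫ (v i₁) ≈ 1#)
       × (∀ (a b : Mat) →
           (a ·M b ≈M (tr a * tr b) ⋆ Id +M sumS₃ (term a b))
           × ((tr a * tr b) ⋆ Id ≈M sI a b ⋆ (e r₁ r₁ +M e r₂ r₂))
           × (term a b (perm i₁ i₂ i₃) ≈M sIII a b ⋆ (e r₁ r₂ +M e r₂ r₂))
           × (term a b (perm i₂ i₃ i₁) ≈M sVII a b ⋆ e r₁ r₁)
           × (term a b (perm i₃ i₁ i₂) ≈M sII a b ⋆ (e r₂ r₁ -M e r₂ r₂))
           × (term a b (perm i₂ i₁ i₃) ≈M sIV a b ⋆ (e r₁ r₁ +M e r₂ r₁))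
           × (term a b (perm i₁ i₃ i₂) ≈M sVI a b ⋆ e r₂ r₂)
           × (term a b (perm i₃ i₂ i₁) ≈M sV a b ⋆ (e r₁ r₂ -M e r₁ r₁))
           × ((a ·M b) r₁ r₁ ≈ sI a b + sIV a b - sV a b + sVII a b)
           × ((a ·M b) r₁ r₂ ≈ sIII a b + sV a b)
           × ((a ·M b) r₂ r₁ ≈ sII a b + sIV a b)
           × ((a ·M b) r₂ r₂ ≈ sI a b - sII a b + sIII a b + sVI a b))
corollary5p3 F =
  at λ₁v₂·λ₂v₃·λ₃v₁≈1 (replicate 8 0#) , λ a b →
    from-entries (specialise trace-formula a b) ,
    from-entries (specialise trace-term≈I a b) ,
    from-entries (specialise term₁₂₃≈III a b) ,
    from-entries (specialise term₂₃₁≈VII a b) ,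
    from-entries (specialise term₃₁₂≈II a b) ,
    from-entries (specialise term₂₁₃≈IV a b) ,
    from-entries (specialise term₁₃₂≈VI a b) ,
    from-entries (specialise term₃₂₁≈V a b) ,
    at strassen₁₁ (point a b) , at strassen₁₂ (point a b) ,
    at strassen₂₁ (point a b) , at strassen₂₂ (point a b)
  where
  open Field F using (commutativeRing)
  open CommutativeRing commutativeRing using (0#)
  open GenericMatrices commutativeRing
  open Specialisation commutativeRing
  open IntegerPolynomials commutativeRing using (at)
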